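{- Let $d\ge3$, $\mathcal A$, $\varphi$, $\mathbf u$, $f$, $T_0,\dots,T_{d-1}$ and $M$ be as in the context, and fix $k\in\mathcal A$. For $n\in\mathbb N$ let $w_n$ be the bispecial factor associated with $f^n(T_{d-1-k})$ and $\vec w_n$ its Parikh vector. Then $\vec w_{n+1}=M\vec w_n+\ell^{(k)}_n$ for all $n\in\mathbb N$, where: for $k=1,2,\dots,d-2$, $$\ell^{(k)}_n=\begin{cases} e_0+e_{d-1} & \text{if } n\equiv k-1 \pmod{d-1}\ \text{or}\ n\equiv d-2\pmod{d-1},\\ e_0&\text{otherwise;}\end{cases}$$ for $k=0$ and $k=d-1$, $$\ell^{(k)}_n=\begin{cases} e_0+2e_{d-1} & \text{if } n\equiv d-2 \pmod{d-1},\\ e_0&\text{otherwise.}\end{cases}$$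
   Context: $\mathcal A=\{0,\dots,d-1\}$; $\varphi(i)=0(i+1)$ for $0\le i\le d-2$, $\varphi(d-1)=0(d-1)(d-1)$; $\mathbf u$ is the fixed point of $\varphi$ starting with $0$, $\mathcal L(\mathbf u)$ its set of finite factors. $M$ is the incidence matrix of $\varphi$: $M_{ij}=|\varphi(j)|_i$ ($|v|_i$ = number of occurrences of $i$ in $v$), and the Parikh vector of $v$ is $(|v|_0,\dots,|v|_{d-1})^T$; $e_0,\dots,e_{d-1}$ is the canonical basis of $\mathbb R^d$. A factor $w$ is bispecial if it has at least two left extensions ($a$ with $aw\in\mathcal L(\mathbf u)$) and at least two right extensions. Let $\mathcal T=\{(a,w,b): w\text{ bispecial factor of }\mathbf u,\ a,b\in\mathcal A,\ a,b<d-1,\ aw,wb\in\mathcal L(\mathbf u)\}$; $w$ is the bispecial factor associated with $(a,w,b)$. For $(a,w,b)\in\mathcal T$ define $f(a,w,b)=(a',w',b')$ with $a'=(a+1)\bmod (d-1)$, $b'=(b+1)\bmod(d-1)$ (residues in $\{0,\dots,d-2\}$) and $w'=\varphi(w)0$ if $a<d-2,b<d-2$; $w'=\varphi(w)0(d-1)$ if $a<d-2,b=d-2$; $w'=(d-1)\varphi(w)0$ if $a=d-2,b<d-2$; $w'=(d-1)\varphi(w)0(d-1)$ if $a=b=d-2$. For $k=0,\dots,d-2$ let $T_k=(0,\varepsilon,k)$, and $T_{d-1}=(0,d-1,0)$. -}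

module Defs where

open import Data.Nat using (ℕ; zero; suc; _+_; _*_; _∸_; _≡ᵇ_; _<ᵇ_; NonZero)
open import Data.Nat.DivMod using (_%_)
open import Data.Bool using (Bool; true; false; if_then_else_; _∨_)
open import Data.List using (List; []; _∷_; _++_; concatMap; map; allFin)
open import Data.Nat.ListAction using (sum)
open import Data.Fin using (Fin; toℕ)
open import Data.Product using (_×_; _,_)

-- Letters of the alphabet A = {0,…,d-1} are represented by natural numbers
-- (only letters < d ever occur); words are lists of letters.
Word : Set
Word = List ℕ

φ : ℕ → ℕ → Word
φ d i = if i <ᵇ d ∸ 1 then 0 ∷ suc i ∷ [] else 0 ∷ (d ∸ 1) ∷ (d ∸ 1) ∷ []

φ* : ℕ → Word → Word
φ* d = concatMap (φ d)

occ : ℕ → Word → ℕ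
occ i [] = 0
occ i (x ∷ v) = (if x ≡ᵇ i then 1 else 0) + occ i v

parikh : (d : ℕ) → Word → (Fin d → ℕ)
parikh d v i = occ (toℕ i) v

M : (d : ℕ) → Fin d → Fin d → ℕ
M d i j = occ (toℕ i) (φ d (toℕ j))

_·ᴹ_ : {d : ℕ} → (Fin d → Fin d → ℕ) → (Fin d → ℕ) → (Fin d → ℕ)
_·ᴹ_ {d} A x i = sum (map (λ j → A i j * x j) (allFin d))

e : {d : ℕ} → ℕ → Fin d → ℕ
e j i = if toℕ i ≡ᵇ j then 1 else 0

_⊕_ : {d : ℕ} → (Fin d → ℕ) → (Fin d → ℕ) → (Fin d → ℕ)
(x ⊕ y) i = x i + y i

_⊙_ : {d : ℕ} → ℕ → (Fin d → ℕ) → (Fin d → ℕ)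
(c ⊙ x) i = c * x i

-- Triples (a , w , b) with a, b ∈ {0,…,d-2} intended.
Triple : Set
Triple = ℕ × Word × ℕ

f : (d : ℕ) → .{{_ : NonZero (d ∸ 1)}} → Triple → Triple
f d (a , w , b) =
  ( suc a % (d ∸ 1)
  , (if a ≡ᵇ d ∸ 2 then (d ∸ 1) ∷ [] else [])
      ++ φ* d w ++ 0 ∷ (if b ≡ᵇ d ∸ 2 then (d ∸ 1) ∷ [] else [])
  , suc b % (d ∸ 1) )

iter : (d : ℕ) → .{{_ : NonZero (d ∸ 1)}} → ℕ → Triple → Triple
iter d zero t = t
iter d (suc n) t = f d (iter d n t)

T : ℕ → ℕ → Triple
T d j = if j <ᵇ d ∸ 1 then (0 , [] , j) else (0 , (d ∸ 1) ∷ [] , 0)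

factor : Triple → Word
factor (a , w , b) = w

wₙ : (d : ℕ) → .{{_ : NonZero (d ∸ 1)}} → (k n : ℕ) → Word
wₙ d k n = factor (iter d n (T d (d ∸ 1 ∸ k)))

ℓ : (d : ℕ) → .{{_ : NonZero (d ∸ 1)}} → (k n : ℕ) → Fin d → ℕ
ℓ d k n =
  if (k ≡ᵇ 0) ∨ (k ≡ᵇ d ∸ 1)
  then (if n % (d ∸ 1) ≡ᵇ d ∸ 2 then e 0 ⊕ (2 ⊙ e (d ∸ 1)) else e 0)
  else (if (n % (d ∸ 1) ≡ᵇ k ∸ 1) ∨ (n % (d ∸ 1) ≡ᵇ d ∸ 2)
        then e 0 ⊕ e (d ∸ 1) else e 0)

{-# OPTIONS --safe #-}
module Submission where

-- f replaces the factor w by φ(w)0, with one more letter d−1 on each side whose index is d−2.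
-- So the Parikh vector of the new factor is M w⃗ + e₀ + c e_{d−1}, where c counts those sides.
-- Starting from T_{d−1−k} = (0, w₀, b₀), the two indices after n steps are n mod (d−1) and
-- (b₀ + n) mod (d−1). For k ∈ {0, d−1} we have b₀ = 0, so both sides fire together exactly when
-- n ≡ d−2. For 1 ≤ k ≤ d−2 we have b₀ = d−1−k, so the right side fires exactly when n ≡ k−1,
-- and this never coincides with n ≡ d−2.

open import Defs
open import Data.Nat
  using (ℕ; zero; suc; _+_; _*_; _∸_; _%_; _≡ᵇ_; pred; _≤_; _<_; z<s; s<s; s≤s⁻¹; _≟_; _<?_;
         NonZero; >-nonZero⁻¹)
open import Data.Nat.Properties
  using (+-*-semiring; +-assoc; +-suc; +-identityʳ; *-identityʳ; *-zeroʳ; *-distribˡ-+;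
         n<1+n; n≮n; <⇒≤; <⇒≢; m∸n+n≡m; n∸n≡0; ∸-monoʳ-<; suc-pred; m≤n⇒m<n∨m≡n)
open import Data.Nat.DivMod using (%-distribˡ-+; m%n%n≡m%n; [m+kn]%n≡m%n; m<n⇒m%n≡m)
open import Data.Nat.Tactic.RingSolver using (solve-∀)
import Data.Nat.ListAction as List
open import Algebra.Properties.Semiring.Sum +-*-semiring
  using (sum-syntax; sum-cong-≗; sum-replicate-zero; ∑-distrib-+)
open import Data.Fin using (Fin; toℕ)
open import Data.Bool using (Bool; true; false; if_then_else_; _∨_)
open import Data.Bool.Properties using (if-cong)
open import Data.List using ([]; _∷_; _++_; map; concatMap; tabulate; allFin)
open import Data.List.Properties using (map-tabulate)
open import Data.List.Relation.Unary.All using (All; []; _∷_)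
open import Data.List.Relation.Unary.All.Properties using (++⁺)
open import Data.Product using (_,_; proj₁; proj₂)
open import Data.Sum using (inj₁; inj₂)
open import Function using (id; _∘_; _⇔_; mk⇔)
open import Relation.Nullary using (Dec; yes; no; ¬_; does; contradiction)
open import Relation.Nullary.Decidable using (dec-true; dec-false; does-⇔)
open import Relation.Binary.PropositionalEquality
  using (_≡_; _≗_; _≢_; refl; sym; trans; subst; cong; cong₂; cong-app; module ≡-Reasoning)

open ≡-Reasoning

⟦_⟧ : Bool → ℕ
⟦ b ⟧ = if b then 1 else 0

≡ᵇ-sym : ∀ x y → (x ≡ᵇ y) ≡ (y ≡ᵇ x)
≡ᵇ-sym x y = does-⇔ (mk⇔ sym sym) (x ≟ y) (y ≟ x)

occ-++ : ∀ t xs ys → occ t (xs ++ ys) ≡ occ t xs + occ t ys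
occ-++ t []       ys = refl
occ-++ t (x ∷ xs) ys = trans (cong (⟦ x ≡ᵇ t ⟧ +_) (occ-++ t xs ys)) (sym (+-assoc ⟦ x ≡ᵇ t ⟧ _ _))

occ-if : ∀ t c x → occ t (if c then x ∷ [] else []) ≡ ⟦ c ⟧ * ⟦ t ≡ᵇ x ⟧
occ-if t true  x = cong (λ b → ⟦ b ⟧ + 0) (≡ᵇ-sym x t)
occ-if t false x = refl

sum-map-allFin : ∀ {n} (g : Fin n → ℕ) → List.sum (map g (allFin n)) ≡ ∑[ j < n ] g j
sum-map-allFin {zero}  g = refl
sum-map-allFin {suc n} g = cong (g Fin.zero +_) (begin
  List.sum (map g (tabulate Fin.suc))      ≡⟨ cong List.sum (map-tabulate Fin.suc g) ⟩
  List.sum (tabulate (g ∘ Fin.suc))        ≡⟨ cong List.sum (map-tabulate id (g ∘ Fin.suc)) ⟨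
  List.sum (map (g ∘ Fin.suc) (allFin n))  ≡⟨ sum-map-allFin (g ∘ Fin.suc) ⟩
  ∑[ j < n ] g (Fin.suc j)                 ∎)
  where import Data.Fin as Fin

∑-*-zeroʳ : ∀ n (g : Fin n → ℕ) → ∑[ j < n ] (g j * 0) ≡ 0
∑-*-zeroʳ n g = trans (sum-cong-≗ (λ j → *-zeroʳ (g j))) (sum-replicate-zero n)

∑-indicator : ∀ {n} (g : ℕ → ℕ) x → x < n → ∑[ j < n ] (g (toℕ j) * ⟦ x ≡ᵇ toℕ j ⟧) ≡ g x
∑-indicator {suc n} g zero _ =
  trans (cong₂ _+_ (*-identityʳ (g 0)) (∑-*-zeroʳ n (g ∘ suc ∘ toℕ))) (+-identityʳ (g 0))
∑-indicator {suc n} g (suc x) x<n =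
  trans (cong (_+ ∑[ j < n ] (g (suc (toℕ j)) * ⟦ x ≡ᵇ toℕ j ⟧)) (*-zeroʳ (g 0)))
        (∑-indicator (g ∘ suc) x (s≤s⁻¹ x<n))

occ-concatMap : ∀ {d} (σ : ℕ → Word) t w → All (_< d) w →
  occ t (concatMap σ w) ≡ ∑[ j < d ] (occ t (σ (toℕ j)) * occ (toℕ j) w)
occ-concatMap {d} σ t []      []            = sym (∑-*-zeroʳ d (λ j → occ t (σ (toℕ j))))
occ-concatMap {d} σ t (x ∷ w) (x<d ∷ w<d) = begin
  occ t (σ x ++ concatMap σ w)
    ≡⟨ occ-++ t (σ x) (concatMap σ w) ⟩
  occ t (σ x) + occ t (concatMap σ w)
    ≡⟨ cong₂ _+_ (sym (∑-indicator (λ y → occ t (σ y)) x x<d)) (occ-concatMap σ t w w<d) ⟩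
  ∑[ j < d ] (c j * ⟦ x ≡ᵇ toℕ j ⟧) + ∑[ j < d ] (c j * occ (toℕ j) w)
    ≡⟨ ∑-distrib-+ (λ j → c j * ⟦ x ≡ᵇ toℕ j ⟧) (λ j → c j * occ (toℕ j) w) ⟨
  ∑[ j < d ] (c j * ⟦ x ≡ᵇ toℕ j ⟧ + c j * occ (toℕ j) w)
    ≡⟨ sum-cong-≗ (λ j → *-distribˡ-+ (c j) ⟦ x ≡ᵇ toℕ j ⟧ (occ (toℕ j) w)) ⟨
  ∑[ j < d ] (c j * occ (toℕ j) (x ∷ w)) ∎
  where
  c : Fin d → ℕ
  c j = occ t (σ (toℕ j))

parikh-φ* : ∀ d w → All (_< d) w → parikh d (φ* d w) ≗ M d ·ᴹ parikh d w
parikh-φ* d w w<d i =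
  trans (occ-concatMap (φ d) (toℕ i) w w<d) (sym (sum-map-allFin (λ j → M d i j * parikh d w j)))

[m+n%d]%d≡[m+n]%d : ∀ m n d .{{_ : NonZero d}} → (m + n % d) % d ≡ (m + n) % d
[m+n%d]%d≡[m+n]%d m n d = begin
  (m + n % d) % d          ≡⟨ %-distribˡ-+ m (n % d) d ⟩
  (m % d + n % d % d) % d  ≡⟨ cong (λ r → (m % d + r) % d) (m%n%n≡m%n n d) ⟩
  (m % d + n % d) % d      ≡⟨ %-distribˡ-+ m n d ⟨
  (m + n) % d              ∎

[m+n]%d≡[m+o]%d⇒n%d≡o%d : ∀ m n o d .{{_ : NonZero d}} → (m + n) % d ≡ (m + o) % d → n % d ≡ o % d
[m+n]%d≡[m+o]%d⇒n%d≡o%d m n o (suc q) eq = begin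
  n % d                          ≡⟨ [m+kn]%n≡m%n n m d ⟨
  (n + m * d) % d                ≡⟨ cong (_% d) (complement n m q) ⟩
  (m * q + (m + n)) % d          ≡⟨ [m+n%d]%d≡[m+n]%d (m * q) (m + n) d ⟨
  (m * q + (m + n) % d) % d      ≡⟨ cong (λ r → (m * q + r) % d) eq ⟩
  (m * q + (m + o) % d) % d      ≡⟨ [m+n%d]%d≡[m+n]%d (m * q) (m + o) d ⟩
  (m * q + (m + o)) % d          ≡⟨ cong (_% d) (complement o m q) ⟨
  (o + m * d) % d                ≡⟨ [m+kn]%n≡m%n o m d ⟩
  o % d                          ∎
  where
  d = suc q
  -- m * q is an additive inverse of m modulo q + 1.
  complement : ∀ x a q → x + a * suc q ≡ a * q + (a + x)
  complement = solve-∀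

%-counter : ∀ {d} .{{_ : NonZero d}} (x : ℕ → ℕ) → x 0 < d → (∀ n → x (suc n) ≡ suc (x n) % d) →
  ∀ n → x n ≡ (x 0 + n) % d
%-counter {d} x x₀<d step zero = sym (trans (cong (_% d) (+-identityʳ (x 0))) (m<n⇒m%n≡m x₀<d))
%-counter {d} x x₀<d step (suc n) = begin
  x (suc n)                ≡⟨ step n ⟩
  suc (x n) % d            ≡⟨ cong (λ r → suc r % d) (%-counter x x₀<d step n) ⟩
  (1 + (x 0 + n) % d) % d  ≡⟨ [m+n%d]%d≡[m+n]%d 1 (x 0 + n) d ⟩
  suc (x 0 + n) % d        ≡⟨ cong (_% d) (+-suc (x 0) n) ⟨
  (x 0 + suc n) % d        ∎

[d∸[1+k]+n]%d≡pred[d]⇔n%d≡k : ∀ {d k} .{{_ : NonZero d}} → k < d →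
  ∀ n → (d ∸ suc k + n) % d ≡ pred d ⇔ n % d ≡ k
[d∸[1+k]+n]%d≡pred[d]⇔n%d≡k {d} {k} k<d n = mk⇔ to from
  where
  s = d ∸ suc k
  1+[s+k]≡d : suc (s + k) ≡ d
  1+[s+k]≡d = trans (sym (+-suc s k)) (m∸n+n≡m k<d)
  [s+k]%d≡pred[d] : (s + k) % d ≡ pred d
  [s+k]%d≡pred[d] = trans (m<n⇒m%n≡m (subst (s + k <_) 1+[s+k]≡d (n<1+n (s + k)))) (cong pred 1+[s+k]≡d)
  to : (s + n) % d ≡ pred d → n % d ≡ k
  to eq = trans ([m+n]%d≡[m+o]%d⇒n%d≡o%d s n k d (trans eq (sym [s+k]%d≡pred[d]))) (m<n⇒m%n≡m k<d)
  from : n % d ≡ k → (s + n) % d ≡ pred d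
  from eq = begin
    (s + n) % d      ≡⟨ [m+n%d]%d≡[m+n]%d s n d ⟨
    (s + n % d) % d  ≡⟨ cong (λ r → (s + r) % d) eq ⟩
    (s + k) % d      ≡⟨ [s+k]%d≡pred[d] ⟩
    pred d           ∎

if-⊕-double : ∀ {n} c (x y : Fin n → ℕ) → (if c then x ⊕ (2 ⊙ y) else x) ≗ x ⊕ ((⟦ c ⟧ + ⟦ c ⟧) ⊙ y)
if-⊕-double true  x y i = refl
if-⊕-double false x y i = sym (+-identityʳ (x i))

if-∨-⊕ : ∀ {n} {P Q : Set} (P? : Dec P) (Q? : Dec Q) → (P → ¬ Q) → (x y : Fin n → ℕ) →
  (if does P? ∨ does Q? then x ⊕ y else x) ≗ x ⊕ ((⟦ does Q? ⟧ + ⟦ does P? ⟧) ⊙ y)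
if-∨-⊕ (yes p) (yes q) P⇒¬Q x y i = contradiction q (P⇒¬Q p)
if-∨-⊕ (yes _) (no _)  _    x y i = cong (x i +_) (sym (+-identityʳ (y i)))
if-∨-⊕ (no _)  (yes _) _    x y i = cong (x i +_) (sym (+-identityʳ (y i)))
if-∨-⊕ (no _)  (no _)  _    x y i = sym (+-identityʳ (x i))

-- The alphabet size is d = suc m, so that d ∸ 1 and d ∸ 2 reduce to m and pred m.
module _ (m : ℕ) .{{_ : NonZero m}} where

  correction : ℕ → ℕ → Fin (suc m) → ℕ
  correction a b = e 0 ⊕ ((⟦ a ≡ᵇ pred m ⟧ + ⟦ b ≡ᵇ pred m ⟧) ⊙ e m)

  φ-alphabet : ∀ x → All (_< suc m) (φ (suc m) x)
  φ-alphabet x = by-cases (x <? m)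
    where
    by-cases : (x<m? : Dec (x < m)) →
               All (_< suc m) (if does x<m? then 0 ∷ suc x ∷ [] else 0 ∷ m ∷ m ∷ [])
    by-cases (yes x<m) = z<s ∷ s<s x<m ∷ []
    by-cases (no _)    = z<s ∷ n<1+n m ∷ n<1+n m ∷ []

  φ*-alphabet : ∀ w → All (_< suc m) (φ* (suc m) w)
  φ*-alphabet []      = []
  φ*-alphabet (x ∷ w) = ++⁺ (φ-alphabet x) (φ*-alphabet w)

  f-alphabet : ∀ t → All (_< suc m) (factor (f (suc m) t))
  f-alphabet (a , w , b) =
    ++⁺ (optional-alphabet (a ≡ᵇ pred m)) (++⁺ (φ*-alphabet w) (z<s ∷ optional-alphabet (b ≡ᵇ pred m)))
    where
    optional-alphabet : ∀ c → All (_< suc m) (if c then m ∷ [] else [])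
    optional-alphabet true  = n<1+n m ∷ []
    optional-alphabet false = []

  iter-alphabet : ∀ {t} → All (_< suc m) (factor t) → ∀ n → All (_< suc m) (factor (iter (suc m) n t))
  iter-alphabet     t-alphabet zero    = t-alphabet
  iter-alphabet {t} _          (suc n) = f-alphabet (iter (suc m) n t)

  parikh-f : ∀ a w b → All (_< suc m) w →
    parikh (suc m) (factor (f (suc m) (a , w , b))) ≗ (M (suc m) ·ᴹ parikh (suc m) w) ⊕ correction a b
  parikh-f a w b w-alphabet i = begin
    occ t (left ++ (φ* (suc m) w ++ (0 ∷ right)))
      ≡⟨ occ-++ t left (φ* (suc m) w ++ (0 ∷ right)) ⟩
    occ t left + occ t (φ* (suc m) w ++ (0 ∷ right))
      ≡⟨ cong (occ t left +_) (occ-++ t (φ* (suc m) w) (0 ∷ right)) ⟩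
    occ t left + (occ t (φ* (suc m) w) + (⟦ 0 ≡ᵇ t ⟧ + occ t right))
      ≡⟨ cong₂ _+_ (occ-if t ca m) (cong₂ _+_ (parikh-φ* (suc m) w w-alphabet i)
                                              (cong₂ _+_ (cong ⟦_⟧ (≡ᵇ-sym 0 t)) (occ-if t cb m))) ⟩
    ⟦ ca ⟧ * ⟦ t ≡ᵇ m ⟧ + (Mw + (⟦ t ≡ᵇ 0 ⟧ + ⟦ cb ⟧ * ⟦ t ≡ᵇ m ⟧))
      ≡⟨ regroup ⟦ ca ⟧ ⟦ cb ⟧ ⟦ t ≡ᵇ m ⟧ ⟦ t ≡ᵇ 0 ⟧ Mw ⟩
    Mw + (⟦ t ≡ᵇ 0 ⟧ + (⟦ ca ⟧ + ⟦ cb ⟧) * ⟦ t ≡ᵇ m ⟧) ∎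
    where
    t = toℕ i
    ca = a ≡ᵇ pred m
    cb = b ≡ᵇ pred m
    left = if ca then m ∷ [] else []
    right = if cb then m ∷ [] else []
    Mw = (M (suc m) ·ᴹ parikh (suc m) w) i
    regroup : ∀ x y u v p → x * u + (p + (v + y * u)) ≡ p + (v + (x + y) * u)
    regroup = solve-∀

  parikh-iter : ∀ {w₀ b₀} → All (_< suc m) w₀ → b₀ < m → ∀ n →
    parikh (suc m) (factor (iter (suc m) (suc n) (0 , w₀ , b₀)))
      ≗ (M (suc m) ·ᴹ parikh (suc m) (factor (iter (suc m) n (0 , w₀ , b₀))))
        ⊕ correction (n % m) ((b₀ + n) % m)
  parikh-iter {w₀} {b₀} w₀-alphabet b₀<m n i = begin
    parikh (suc m) (factor (f (suc m) tₙ)) i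
      ≡⟨ parikh-f a w b (iter-alphabet w₀-alphabet n) i ⟩
    Mw + correction a b i
      ≡⟨ cong₂ (λ a b → Mw + correction a b i) left-index right-index ⟩
    Mw + correction (n % m) ((b₀ + n) % m) i ∎
    where
    tₙ = iter (suc m) n (0 , w₀ , b₀)
    a = proj₁ tₙ
    w = proj₁ (proj₂ tₙ)
    b = proj₂ (proj₂ tₙ)
    Mw = (M (suc m) ·ᴹ parikh (suc m) w) i
    left-index : a ≡ n % m
    left-index = %-counter (λ j → proj₁ (iter (suc m) j (0 , w₀ , b₀))) (>-nonZero⁻¹ m) (λ _ → refl) n
    right-index : b ≡ (b₀ + n) % m
    right-index = %-counter (λ j → proj₂ (proj₂ (iter (suc m) j (0 , w₀ , b₀)))) b₀<m (λ _ → refl) n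

  T-below : ∀ {j} → j < m → T (suc m) j ≡ (0 , [] , j)
  T-below {j} j<m = if-cong (dec-true (j <? m) j<m)

  T-last : T (suc m) m ≡ (0 , m ∷ [] , 0)
  T-last = if-cong (dec-false (m <? m) (n≮n m))

  ℓ-boundary : ∀ k → (k ≡ᵇ 0) ∨ (k ≡ᵇ m) ≡ true → ∀ n → ℓ (suc m) k n ≗ correction (n % m) (n % m)
  ℓ-boundary k boundary n i =
    trans (cong-app (if-cong boundary) i) (if-⊕-double (n % m ≡ᵇ pred m) (e 0) (e m) i)

  ℓ-interior : ∀ {k} → suc k < m → ∀ n → ℓ (suc m) (suc k) n ≗ correction (n % m) ((m ∸ suc k + n) % m)
  ℓ-interior {k} 1+k<m n i = begin
    ℓ (suc m) (suc k) n i
      ≡⟨ cong-app (if-cong (dec-false (suc k ≟ m) (<⇒≢ 1+k<m))) i ⟩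
    (if (n % m ≡ᵇ k) ∨ (n % m ≡ᵇ pred m) then e 0 ⊕ e m else e 0) i
      ≡⟨ if-∨-⊕ (n % m ≟ k) (n % m ≟ pred m) k≢pred[m] (e 0) (e m) i ⟩
    e 0 i + (⟦ n % m ≡ᵇ pred m ⟧ + ⟦ n % m ≡ᵇ k ⟧) * e m i
      ≡⟨ cong (λ c → e 0 i + (⟦ n % m ≡ᵇ pred m ⟧ + ⟦ c ⟧) * e m i) right-index≡pred[m] ⟨
    correction (n % m) ((m ∸ suc k + n) % m) i ∎
    where
    k≢pred[m] : n % m ≡ k → n % m ≢ pred m
    k≢pred[m] p q = <⇒≢ 1+k<m (trans (cong suc (trans (sym p) q)) (suc-pred m))
    right-index≡pred[m] : ((m ∸ suc k + n) % m ≡ᵇ pred m) ≡ (n % m ≡ᵇ k)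
    right-index≡pred[m] =
      does-⇔ ([d∸[1+k]+n]%d≡pred[d]⇔n%d≡k (<⇒≤ 1+k<m) n) ((m ∸ suc k + n) % m ≟ pred m) (n % m ≟ k)

  wₙ-recurrence : ∀ k {w₀ b₀} → T (suc m) (m ∸ k) ≡ (0 , w₀ , b₀) → All (_< suc m) w₀ → b₀ < m →
    (∀ n → ℓ (suc m) k n ≗ correction (n % m) ((b₀ + n) % m)) →
    ∀ n i → parikh (suc m) (wₙ (suc m) k (suc n)) i
            ≡ ((M (suc m) ·ᴹ parikh (suc m) (wₙ (suc m) k n)) ⊕ ℓ (suc m) k n) i
  wₙ-recurrence k start w₀-alphabet b₀<m ℓ≗correction n i =
    subst (λ t → parikh (suc m) (factor (iter (suc m) (suc n) t)) i
                 ≡ ((M (suc m) ·ᴹ parikh (suc m) (factor (iter (suc m) n t))) ⊕ ℓ (suc m) k n) i)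
          (sym start)
          (trans (parikh-iter w₀-alphabet b₀<m n i) (cong (_ +_) (sym (ℓ≗correction n i))))

proposition14 : (d : ℕ) → 3 ≤ d → .{{_ : NonZero (d ∸ 1)}} → (k : ℕ) → k < d → (n : ℕ) → (i : Fin d)
    → parikh d (wₙ d k (suc n)) i ≡ (((M d) ·ᴹ (parikh d (wₙ d k n))) ⊕ ℓ d k n) i
proposition14 (suc m) _ zero _ =
  wₙ-recurrence m 0 (T-last m) (n<1+n m ∷ []) (>-nonZero⁻¹ m) (ℓ-boundary m 0 refl)
proposition14 (suc m) _ (suc k) k<d with m≤n⇒m<n∨m≡n (s≤s⁻¹ k<d)
... | inj₁ 1+k<m = wₙ-recurrence m (suc k) (T-below m b₀<m) [] b₀<m (ℓ-interior m 1+k<m)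
  where
  b₀<m : m ∸ suc k < m
  b₀<m = ∸-monoʳ-< z<s (<⇒≤ 1+k<m)
... | inj₂ refl =
  wₙ-recurrence (suc k) (suc k) (trans (cong (T (suc (suc k))) (n∸n≡0 k)) (T-below (suc k) z<s)) [] z<s
    (ℓ-boundary (suc k) (suc k) (dec-true (k ≟ k) refl))
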